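{- Let $q > 5$ be a Sophie Germain prime with $z(2q+1) \mid \pi(q)$. Then $q \equiv 8 \pmod{15}$.
   Context: A Sophie Germain prime is a prime $q$ with $2q+1$ prime. $F_n$ denotes the $n$-th Fibonacci number ($F_0=0$, $F_1=1$, $F_n=F_{n-1}+F_{n-2}$). For a prime $p$, $z(p)$ is the smallest positive integer $k$ with $p \mid F_k$. For a positive integer $n$, the Pisano period $\pi(n)$ is the period of $(F_m \bmod n)_{m\ge0}$. -}

module Defs where

open import Data.Nat using (ℕ; zero; suc; _+_; _*_; _<_; _≤_; _%_; NonZero)
open import Data.Nat.Divisibility using (_∣_)
open import Data.Nat.Primality using (Prime)
open import Data.Product using (_×_)
open import Relation.Binary.PropositionalEquality using (_≡_)

fib : ℕ → ℕ
fib zero = zero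
fib (suc zero) = suc zero
fib (suc (suc n)) = fib (suc n) + fib n

SophieGermain : ℕ → Set
SophieGermain q = Prime q × Prime (2 * q + 1)

IsRankOfApparition : ℕ → ℕ → Set
IsRankOfApparition p k =
  0 < k × p ∣ fib k × (∀ j → 0 < j → p ∣ fib j → k ≤ j)

IsFibPeriodMod : (n : ℕ) → .{{NonZero n}} → ℕ → Set
IsFibPeriodMod n m = ∀ i → fib (i + m) % n ≡ fib i % n

IsPisanoPeriod : (n : ℕ) → .{{NonZero n}} → ℕ → Set
IsPisanoPeriod n m =
  0 < m × IsFibPeriodMod n m × (∀ m' → 0 < m' → IsFibPeriodMod n m' → m ≤ m')

-- Write p = 2q + 1. As q and p are primes greater than 5, q ≡ 2 (mod 3) and
-- q ≢ 0, 2 (mod 5). For a prime ℓ ≠ 2, 5 let g = ζ − ζ² − ζ³ + ζ⁴ be the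
-- Gauss sum in ℤ[ζ₅]; it plays the role of √5, and since g = ζ(1 − ζ)(1 − ζ²)
-- the Frobenius congruence gives gˡ ≡ (ℓ/5) g (mod ℓ). Expanding (1 + g)ˡ and
-- (1 + g)ˡ⁺¹ then shows ℓ ∣ F(ℓ − 1) and F(ℓ) ≡ 1 when ℓ ≡ ±1 (mod 5), and
-- ℓ ∣ F(ℓ + 1) when ℓ ≡ ±2 (mod 5). If q ≡ 1 (mod 5), then z(p) ∣ π(q) ∣ q − 1
-- and z(p) ∣ p + 1 = 2(q − 1) + 4; if q ≡ 4 (mod 5), then z(p) ∣ q − 1 and
-- z(p) ∣ p − 1 = 2(q − 1) + 2. Either way z(p) ∣ 4, which is impossible because
-- p ∣ F(z(p)) ∣ F(4) = 3. Hence q ≡ 3 (mod 5), i.e. q ≡ 8 (mod 15).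
module Submission where

open import Algebra.Bundles using (CommutativeSemiring; CommutativeRing)
open import Data.Nat.Base as ℕ using (ℕ; zero; suc)

module FibonacciDivisibility where

  open import Data.Nat.Base
  open import Data.Nat.Properties
  open import Data.Nat.Divisibility
  open import Data.Nat.DivMod
  open import Data.Nat.Primality using (Prime; euclidsLemma; prime⇒nonTrivial)
  open import Data.Nat.Coprimality as Coprime using (Coprime; coprime-+)
  open import Data.Nat.Tactic.RingSolver using (solve-∀)
  open import Data.Product using (_×_; _,_; proj₁)
  open import Data.Sum using (inj₁; inj₂)
  open import Relation.Nullary using (contradiction)
  open import Relation.Binary.PropositionalEquality
  open import Defs

  -- IsRankOfApparition p and IsPisanoPeriod n unfold to IsLeastPositive of p ∣ fib _ and IsFibPeriodMod n.
  IsLeastPositive : (ℕ → Set) → ℕ → Set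
  IsLeastPositive P z = 0 < z × P z × (∀ j → 0 < j → P j → z ≤ j)

  leastPositive∣ : ∀ {P : ℕ → Set} →
    (∀ a b → P a → P b → P (a + b)) → (∀ a b → P a → P (a + b) → P b) →
    ∀ {z n} → IsLeastPositive P z → P n → z ∣ n
  leastPositive∣ {P} closed-+ closed-∸ {z} {n} (z>0 , Pz , least) Pn = m%n≡0⇒n∣m n z n%z≡0
    where
    instance _ = >-nonZero z>0
    multiples : ∀ k → P (k * z)
    multiples zero    = closed-∸ z 0 Pz (subst P (sym (+-identityʳ z)) Pz)
    multiples (suc k) = closed-+ z (k * z) Pz (multiples k)
    P[n%z] : P (n % z)
    P[n%z] = closed-∸ (n / z * z) (n % z) (multiples (n / z))
      (subst P (trans (m≡m%n+[m/n]*n n z) (+-comm (n % z) _)) Pn)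
    n%z≡0 : n % z ≡ 0
    n%z≡0 = n≤0⇒n≡0 (≮⇒≥ λ n%z>0 → <⇒≱ (m%n<n n z) (least (n % z) n%z>0 P[n%z]))

  fib-+ : ∀ m n → fib (m + suc n) ≡ fib (suc m) * fib (suc n) + fib m * fib n
  fib-+ zero          n = sym (trans (+-identityʳ _) (*-identityˡ _))
  fib-+ (suc zero)    n = sym (cong₂ _+_ (*-identityˡ (fib (suc n))) (*-identityˡ (fib n)))
  fib-+ (suc (suc m)) n = begin
    fib (suc m + suc n) + fib (m + suc n)  ≡⟨ cong₂ _+_ (fib-+ (suc m) n) (fib-+ m n) ⟩
    (F₂ * a + F₁ * b) + (F₁ * a + F₀ * b)  ≡⟨ regroup F₂ F₁ F₀ a b ⟩
    (F₂ + F₁) * a + (F₁ + F₀) * b          ∎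
    where
    open ≡-Reasoning
    F₂ = fib (suc (suc m)); F₁ = fib (suc m); F₀ = fib m
    a = fib (suc n); b = fib n
    regroup : ∀ F₂ F₁ F₀ a b → (F₂ * a + F₁ * b) + (F₁ * a + F₀ * b) ≡ (F₂ + F₁) * a + (F₁ + F₀) * b
    regroup = solve-∀

  fib-coprime : ∀ n → Coprime (fib n) (fib (suc n))
  fib-coprime zero    (_ , d∣1) = ∣1⇒≡1 d∣1
  fib-coprime (suc n) = Coprime.sym (coprime-+ (fib-coprime n))

  ∣fib-+ : ∀ {d} m n → d ∣ fib m → d ∣ fib n → d ∣ fib (m + n)
  ∣fib-+ {d} m zero    d∣Fm _    = subst (d ∣_) (cong fib (sym (+-identityʳ m))) d∣Fm
  ∣fib-+ {d} m (suc n) d∣Fm d∣Fn = subst (d ∣_) (sym (fib-+ m n))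
    (∣m∣n⇒∣m+n (∣n⇒∣m*n (fib (suc m)) d∣Fn) (∣m⇒∣m*n (fib n) d∣Fm))

  ∣fib-* : ∀ {d} k n → d ∣ fib n → d ∣ fib (k * n)
  ∣fib-* zero    n _    = _ ∣0
  ∣fib-* (suc k) n d∣Fn = ∣fib-+ n (k * n) d∣Fn (∣fib-* k n d∣Fn)

  ∣fib-+⇒∣fib : ∀ {p} → Prime p → ∀ m n → p ∣ fib m → p ∣ fib (m + n) → p ∣ fib n
  ∣fib-+⇒∣fib {p} _  m zero    _    _       = p ∣0
  ∣fib-+⇒∣fib {p} pp m (suc n) p∣Fm p∣Fm+n with euclidsLemma (fib (suc m)) (fib (suc n)) pp p∣product
    where
    p∣product : p ∣ fib (suc m) * fib (suc n)
    p∣product = ∣m+n∣m⇒∣n (subst (p ∣_) (trans (fib-+ m n) (+-comm (fib (suc m) * fib (suc n)) _)) p∣Fm+n)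
      (∣m⇒∣m*n (fib n) p∣Fm)
  ... | inj₁ p∣Fm+1 = contradiction (fib-coprime m (p∣Fm , p∣Fm+1)) (nonTrivial⇒≢1 {{prime⇒nonTrivial pp}})
  ... | inj₂ p∣Fn+1 = p∣Fn+1

  rank∣ : ∀ {p z n} → Prime p → IsRankOfApparition p z → p ∣ fib n → z ∣ n
  rank∣ {p} pp = leastPositive∣ {P = λ k → p ∣ fib k} ∣fib-+ (∣fib-+⇒∣fib pp)

  module _ {n} .{{_ : NonZero n}} where

    period-+ : ∀ a b → IsFibPeriodMod n a → IsFibPeriodMod n b → IsFibPeriodMod n (a + b)
    period-+ a b per-a per-b i = begin
      fib (i + (a + b)) % n ≡⟨ cong (λ k → fib k % n) (sym (+-assoc i a b)) ⟩
      fib (i + a + b) % n   ≡⟨ per-b (i + a) ⟩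
      fib (i + a) % n       ≡⟨ per-a i ⟩
      fib i % n             ∎
      where open ≡-Reasoning

    period-∸ : ∀ a b → IsFibPeriodMod n a → IsFibPeriodMod n (a + b) → IsFibPeriodMod n b
    period-∸ a b per-a per-a+b i = begin
      fib (i + b) % n       ≡⟨ per-a (i + b) ⟨
      fib (i + b + a) % n   ≡⟨ cong (λ k → fib k % n) (trans (+-assoc i b a) (cong (i +_) (+-comm b a))) ⟩
      fib (i + (a + b)) % n ≡⟨ per-a+b i ⟩
      fib i % n             ∎
      where open ≡-Reasoning

    pisano∣ : ∀ {π m} → IsPisanoPeriod n π → IsFibPeriodMod n m → π ∣ m
    pisano∣ = leastPositive∣ {P = IsFibPeriodMod n} period-+ period-∸

    restart⇒period : ∀ {m} → fib m % n ≡ 0 → fib (suc m) % n ≡ 1 % n → IsFibPeriodMod n m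
    restart⇒period {m} Fm≡0 Fm+1≡1 i = proj₁ (consecutive i)
      where
      consecutive : ∀ i → fib (i + m) % n ≡ fib i % n × fib (suc i + m) % n ≡ fib (suc i) % n
      consecutive zero    = trans Fm≡0 (sym (m<n⇒m%n≡m (>-nonZero⁻¹ n))) , Fm+1≡1
      consecutive (suc i) with consecutive i
      ... | eq₀ , eq₁ = eq₁ , (begin
        (fib (suc i + m) + fib (i + m)) % n          ≡⟨ %-distribˡ-+ (fib (suc i + m)) (fib (i + m)) n ⟩
        (fib (suc i + m) % n + fib (i + m) % n) % n  ≡⟨ cong₂ (λ a b → (a + b) % n) eq₁ eq₀ ⟩
        (fib (suc i) % n + fib i % n) % n            ≡⟨ %-distribˡ-+ (fib (suc i)) (fib i) n ⟨
        (fib (suc i) + fib i) % n                    ∎)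
        where open ≡-Reasoning

module PrimeBinomial where

  open import Data.Nat.Base
  open import Data.Nat.Properties
  open import Data.Nat.Divisibility
  open import Data.Nat.DivMod using (m/n*n≡m)
  open import Data.Nat.Primality using (Prime; euclidsLemma; prime⇒nonTrivial; prime⇒nonZero)
  open import Data.Nat.Combinatorics using (_C_; nCk≡n!/k![n-k]!; k![n∸k]!∣n!)
  open import Data.Nat.Coprimality using (coprime-divisor; prime⇒coprime)
  open import Data.Sum using (inj₁; inj₂)
  open import Relation.Nullary using (¬_; contradiction)
  open import Relation.Binary.PropositionalEquality

  prime∤! : ∀ {p} → Prime p → ∀ {m} → m < p → ¬ p ∣ m !
  prime∤! pp {zero}  _     p∣1 = nonTrivial⇒≢1 {{prime⇒nonTrivial pp}} (∣1⇒≡1 p∣1)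
  prime∤! pp {suc m} m+1<p p∣ = prime∤! pp (<⇒≤ m+1<p) (coprime-divisor (prime⇒coprime pp m+1<p) p∣)

  prime∣C : ∀ {p k} → Prime p → 0 < k → k < p → p ∣ p C k
  prime∣C {p} {k} pp 0<k k<p with euclidsLemma (p C k) (k ! * (p ∸ k) !) pp p∣C*d
    where
    instance _ = k !* (p ∸ k) !≢0
    C*d≡p! : (p C k) * (k ! * (p ∸ k) !) ≡ p !
    C*d≡p! = trans (cong (_* (k ! * (p ∸ k) !)) (nCk≡n!/k![n-k]! (<⇒≤ k<p))) (m/n*n≡m (k![n∸k]!∣n! (<⇒≤ k<p)))
    p∣C*d : p ∣ (p C k) * (k ! * (p ∸ k) !)
    p∣C*d = subst (p ∣_) (sym C*d≡p!) (n∣n! p {{prime⇒nonZero pp}})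
      where
      n∣n! : ∀ n → .{{NonZero n}} → n ∣ n !
      n∣n! (suc n) = m∣m*n (n !)
  ... | inj₁ p∣C = p∣C
  ... | inj₂ p∣d with euclidsLemma (k !) ((p ∸ k) !) pp p∣d
  ...   | inj₁ p∣k!     = contradiction p∣k! (prime∤! pp k<p)
  ...   | inj₂ p∣[p-k]! = contradiction p∣[p-k]! (prime∤! pp (∸-monoʳ-< 0<k (<⇒≤ k<p)))

module Congruence {c ℓ} (R : CommutativeSemiring c ℓ) (p : ℕ) where

  open CommutativeSemiring R hiding (zero)
  open import Algebra.Properties.Semiring.Mult semiring using (_×_; ×-congˡ; ×-assoc-*; ×-assocˡ)
  open import Algebra.Properties.CommutativeMonoid.Mult +-commutativeMonoid using (×-distrib-+)
  open import Algebra.Properties.CommutativeSemigroup +-commutativeSemigroup using (xy∙z≈xz∙y)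
  open import Algebra.Properties.Semiring.Exp semiring using (_^_)
  import Algebra.Properties.CommutativeSemiring.Binomial R as Binomial
  open import Algebra.Properties.Monoid.Sum +-monoid using (sum; sum-init-last)
  open import Data.Fin.Base using (zero; suc; toℕ; inject₁; fromℕ)
  open import Data.Fin.Properties using (toℕ<n; toℕ-inject₁; toℕ-fromℕ)
  open import Data.Integer.Base as ℤ using (ℤ; +_; 0ℤ)
  import Data.Integer.Properties as ℤ
  open import Data.Integer.Divisibility.Signed using (divides) renaming (_∣_ to _∣ℤ_)
  open import Data.Integer.Tactic.RingSolver using (solve-∀)
  open import Data.Nat.Combinatorics using (_C_; nCn≡1)
  import Data.Nat.Properties as ℕ
  open import Data.Nat.Divisibility using (_∣_; divides)
  open import Data.Nat.Primality using (Prime; prime⇒nonZero)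
  open import Data.Vec.Functional using (Vector; init; tail)
  open import Function.Base using (_∘_)
  open import Level using (_⊔_)
  open import Relation.Binary.Core using (_⇒_)
  open import Relation.Binary.Bundles using (Preorder)
  open import Relation.Binary.Structures using (IsPreorder)
  open import Relation.Binary.Definitions using (Reflexive; Symmetric; Transitive)
  import Relation.Binary.PropositionalEquality as ≡
  open PrimeBinomial using (prime∣C)

  -- Congruence modulo the ideal p R, phrased without subtraction so that it makes sense in a semiring.
  infix 4 _≋_
  record _≋_ (x y : Carrier) : Set (c ⊔ ℓ) where
    constructor congruent
    field
      a b : Carrier
      equation : x + p × a ≈ y + p × b

  ≋-reflexive : _≈_ ⇒ _≋_
  ≋-reflexive x≈y = congruent 0# 0# (+-congʳ x≈y)

  ≋-refl : Reflexive _≋_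
  ≋-refl = ≋-reflexive refl

  ≋-sym : Symmetric _≋_
  ≋-sym (congruent a b eq) = congruent b a (sym eq)

  ≋-trans : Transitive _≋_
  ≋-trans {x} {y} {z} (congruent a b x≋y) (congruent c d y≋z) = congruent (a + c) (d + b) (begin
    x + p × (a + c)     ≈⟨ shift x a c ⟩
    x + p × a + p × c   ≈⟨ +-congʳ x≋y ⟩
    y + p × b + p × c   ≈⟨ xy∙z≈xz∙y y _ _ ⟩
    y + p × c + p × b   ≈⟨ +-congʳ y≋z ⟩
    z + p × d + p × b   ≈⟨ shift z d b ⟨
    z + p × (d + b)     ∎)
    where
    open import Relation.Binary.Reasoning.Setoid setoid
    shift : ∀ u a c → u + p × (a + c) ≈ u + p × a + p × c
    shift u a c = trans (+-congˡ (×-distrib-+ a c p)) (sym (+-assoc u _ _))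

  ≋-isPreorder : IsPreorder _≈_ _≋_
  ≋-isPreorder = record { isEquivalence = isEquivalence ; reflexive = ≋-reflexive ; trans = ≋-trans }

  ≋-preorder : Preorder c ℓ (c ⊔ ℓ)
  ≋-preorder = record { isPreorder = ≋-isPreorder }

  ≋-+ʳ : ∀ {x y} z → x ≋ y → x + z ≋ y + z
  ≋-+ʳ {x} {y} z (congruent a b x≋y) = congruent a b (begin
    x + z + p × a   ≈⟨ xy∙z≈xz∙y x z _ ⟩
    x + p × a + z   ≈⟨ +-congʳ x≋y ⟩
    y + p × b + z   ≈⟨ xy∙z≈xz∙y y _ z ⟩
    y + z + p × b   ∎)
    where open import Relation.Binary.Reasoning.Setoid setoid

  ≋-*ʳ : ∀ {x y} z → x ≋ y → x * z ≋ y * z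
  ≋-*ʳ {x} {y} z (congruent a b x≋y) = congruent (a * z) (b * z) (begin
    x * z + p × (a * z)   ≈⟨ +-congˡ (×-assoc-* p a z) ⟨
    x * z + p × a * z     ≈⟨ distribʳ z x _ ⟨
    (x + p × a) * z       ≈⟨ *-congʳ x≋y ⟩
    (y + p × b) * z       ≈⟨ distribʳ z y _ ⟩
    y * z + p × b * z     ≈⟨ +-congˡ (×-assoc-* p b z) ⟩
    y * z + p × (b * z)   ∎)
    where open import Relation.Binary.Reasoning.Setoid setoid

  ≋-+ : ∀ {x y u v} → x ≋ y → u ≋ v → x + u ≋ y + v
  ≋-+ {x} {y} {u} {v} x≋y u≋v = ≋-trans (≋-+ʳ u x≋y)
    (≋-trans (≋-reflexive (+-comm y u)) (≋-trans (≋-+ʳ y u≋v) (≋-reflexive (+-comm v y))))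

  ≋-* : ∀ {x y u v} → x ≋ y → u ≋ v → x * u ≋ y * v
  ≋-* {x} {y} {u} {v} x≋y u≋v = ≋-trans (≋-*ʳ u x≋y)
    (≋-trans (≋-reflexive (*-comm y u)) (≋-trans (≋-*ʳ y u≋v) (≋-reflexive (*-comm v y))))

  ∣⇒×≋0 : ∀ {n} → p ∣ n → ∀ x → n × x ≋ 0#
  ∣⇒×≋0 (divides k ≡.refl) x = congruent 0# (k × x) (begin
    (k ℕ.* p) × x + p × 0#   ≈⟨ +-cong (×-congˡ (ℕ.*-comm k p)) (×-zeroʳ p) ⟩
    (p ℕ.* k) × x + 0#       ≈⟨ +-comm _ 0# ⟩
    0# + (p ℕ.* k) × x       ≈⟨ +-congˡ (×-assocˡ x p k) ⟨
    0# + p × (k × x)         ∎)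
    where
    open import Relation.Binary.Reasoning.Setoid setoid
    ×-zeroʳ : ∀ n → n × 0# ≈ 0#
    ×-zeroʳ zero    = refl
    ×-zeroʳ (suc n) = trans (+-identityˡ _) (×-zeroʳ n)

  sum≋0 : ∀ {n} (t : Vector Carrier n) → (∀ i → t i ≋ 0#) → sum t ≋ 0#
  sum≋0 {zero}  t t≋0 = ≋-refl
  sum≋0 {suc n} t t≋0 = ≋-trans (≋-+ (t≋0 zero) (sum≋0 (tail t) (t≋0 ∘ suc))) (≋-reflexive (+-identityˡ 0#))

  frobenius : Prime p → ∀ x y → (x + y) ^ p ≋ x ^ p + y ^ p
  frobenius pp x y = expand (ℕ.pred p) (ℕ.suc-pred p {{prime⇒nonZero pp}})
    where
    open import Relation.Binary.Reasoning.Preorder ≋-preorder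
    expand : ∀ m → suc m ≡.≡ p → (x + y) ^ p ≋ x ^ p + y ^ p
    expand m ≡.refl = begin
      (x + y) ^ suc m                                        ≈⟨ Binomial.theorem (suc m) x y ⟩
      t zero + sum (tail t)                                  ≈⟨ +-cong first-term (sum-init-last (tail t)) ⟩
      y ^ suc m + (sum (init (tail t)) + t (suc (fromℕ m)))
        ∼⟨ ≋-+ ≋-refl (≋-+ (sum≋0 _ middle≋0) (≋-reflexive last-term)) ⟩
      y ^ suc m + (0# + x ^ suc m)                           ≈⟨ +-comm _ _ ⟩
      0# + x ^ suc m + y ^ suc m                             ≈⟨ +-congʳ (+-identityˡ _) ⟩
      x ^ suc m + y ^ suc m                                  ∎
      where
      t = Binomial.binomialTerm x y (suc m)
      first-term : t zero ≈ y ^ suc m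
      first-term = trans (+-identityʳ _) (*-identityˡ _)
      last-term : t (suc (fromℕ m)) ≈ x ^ suc m
      last-term = begin-equality
        t (suc (fromℕ m))
          ≡⟨ ≡.cong (λ k → (suc m C k) × (x ^ k * y ^ (suc m ℕ.∸ k))) (≡.cong suc (toℕ-fromℕ m)) ⟩
        (suc m C suc m) × (x ^ suc m * y ^ (m ℕ.∸ m))
          ≡⟨ ≡.cong₂ (λ c e → c × (x ^ suc m * y ^ e)) (nCn≡1 (suc m)) (ℕ.n∸n≡0 m) ⟩
        1 × (x ^ suc m * 1#)
          ≈⟨ trans (+-identityʳ _) (*-identityʳ _) ⟩
        x ^ suc m
          ∎
      middle≋0 : ∀ i → init (tail t) i ≋ 0#
      middle≋0 i = ∣⇒×≋0 (prime∣C {k = suc (toℕ (inject₁ i))} pp ℕ.z<s (ℕ.s<s i<m)) _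
        where
        i<m : toℕ (inject₁ i) ℕ.< m
        i<m = ≡.subst (ℕ._< m) (≡.sym (toℕ-inject₁ i)) (toℕ<n i)

  module _ (f : Carrier → ℤ) (f-cong : ∀ {x y} → x ≈ y → f x ≡.≡ f y) (f-0# : f 0# ≡.≡ 0ℤ)
           (f-+ : ∀ x y → f (x + y) ≡.≡ f x ℤ.+ f y) where

    f-× : ∀ n x → f (n × x) ≡.≡ + n ℤ.* f x
    f-× zero    x = f-0#
    f-× (suc n) x = ≡.trans (f-+ x (n × x)) (≡.trans (≡.cong (λ z → f x ℤ.+ z) (f-× n x)) (≡.sym (ℤ.suc-* (+ n) (f x))))

    ≋⇒∣ : ∀ {x y} → x ≋ y → + p ∣ℤ f x ℤ.- f y
    ≋⇒∣ {x} {y} (congruent a b x+pa≈y+pb) = divides (f b ℤ.- f a) (begin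
      f x ℤ.- f y                              ≡⟨ difference (f x) (f y) (f a) (f b) (+ p) ⟩
      (X ℤ.- Y) ℤ.+ (f b ℤ.- f a) ℤ.* + p      ≡⟨ ≡.cong (λ z → (z ℤ.- Y) ℤ.+ (f b ℤ.- f a) ℤ.* + p) X≡Y ⟩
      (Y ℤ.- Y) ℤ.+ (f b ℤ.- f a) ℤ.* + p      ≡⟨ ≡.cong (ℤ._+ (f b ℤ.- f a) ℤ.* + p) (ℤ.+-inverseʳ Y) ⟩
      0ℤ ℤ.+ (f b ℤ.- f a) ℤ.* + p             ≡⟨ ℤ.+-identityˡ _ ⟩
      (f b ℤ.- f a) ℤ.* + p                    ∎)
      where
      open ≡.≡-Reasoning
      X = f x ℤ.+ + p ℤ.* f a
      Y = f y ℤ.+ + p ℤ.* f b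
      X≡Y : X ≡.≡ Y
      X≡Y = begin
        f x ℤ.+ + p ℤ.* f a   ≡⟨ ≡.sym (≡.trans (f-+ x (p × a)) (≡.cong (λ z → f x ℤ.+ z) (f-× p a))) ⟩
        f (x + p × a)         ≡⟨ f-cong x+pa≈y+pb ⟩
        f (y + p × b)         ≡⟨ ≡.trans (f-+ y (p × b)) (≡.cong (λ z → f y ℤ.+ z) (f-× p b)) ⟩
        f y ℤ.+ + p ℤ.* f b   ∎
      difference : ∀ X Y A B P → X ℤ.- Y ≡.≡ ((X ℤ.+ P ℤ.* A) ℤ.- (Y ℤ.+ P ℤ.* B)) ℤ.+ (B ℤ.- A) ℤ.* P
      difference = solve-∀

module RingCongruence {c ℓ} (R : CommutativeRing c ℓ) (p : ℕ) where

  open CommutativeRing R hiding (zero)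
  open Congruence commutativeSemiring p public
  open import Algebra.Properties.Semiring.Exp semiring using (_^_; ^-congˡ)
  open import Data.Nat.Primality using (Prime; prime⇒nonZero)
  open import Data.Nat.Properties using (suc-pred)
  import Relation.Binary.PropositionalEquality as ≡
  open import Relation.Binary.Reasoning.Preorder ≋-preorder

  -- Frobenius applied to x + (- x) = 0; no parity assumption on p is needed.
  frobenius-neg : Prime p → ∀ x → (- x) ^ p ≋ - (x ^ p)
  frobenius-neg pp x = ≋-sym (begin
    - x ^ p                       ≈⟨ +-identityʳ _ ⟨
    - x ^ p + 0#                  ≈⟨ +-congˡ [x-x]^p≈0 ⟨
    - x ^ p + (x + - x) ^ p       ∼⟨ ≋-+ ≋-refl (frobenius pp x (- x)) ⟩
    - x ^ p + (x ^ p + (- x) ^ p) ≈⟨ +-assoc _ _ _ ⟨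
    - x ^ p + x ^ p + (- x) ^ p   ≈⟨ +-congʳ (-‿inverseˡ _) ⟩
    0# + (- x) ^ p                ≈⟨ +-identityˡ _ ⟩
    (- x) ^ p                     ∎)
    where
    0^p : ∀ m → suc m ≡.≡ p → 0# ^ p ≈ 0#
    0^p m ≡.refl = zeroˡ _
    [x-x]^p≈0 : (x + - x) ^ p ≈ 0#
    [x-x]^p≈0 = trans (^-congˡ p (-‿inverseʳ x)) (0^p (ℕ.pred p) (suc-pred p {{prime⇒nonZero pp}}))

module Powers {c ℓ} (R : CommutativeSemiring c ℓ) where

  open CommutativeSemiring R hiding (zero)
  open import Algebra.Properties.Semiring.Exp semiring using (_^_; ^-congˡ; ^-homo-*; ^-assocʳ)
  open import Data.Nat.Base using (NonZero)
  open import Data.Nat.DivMod using (_%_; _/_; m≡m%n+[m/n]*n)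
  import Data.Nat.Properties as ℕ
  import Relation.Binary.PropositionalEquality as ≡
  open import Relation.Binary.Reasoning.Setoid setoid

  1^ : ∀ n → 1# ^ n ≈ 1#
  1^ zero    = refl
  1^ (suc n) = trans (*-identityˡ _) (1^ n)

  ^-% : ∀ {x} d .{{_ : NonZero d}} → x ^ d ≈ 1# → ∀ n → x ^ n ≈ x ^ (n % d)
  ^-% {x} d x^d≈1 n = begin
    x ^ n                              ≡⟨ ≡.cong (x ^_) n≡n%d+d*[n/d] ⟩
    x ^ (n % d ℕ.+ d ℕ.* (n / d))      ≈⟨ ^-homo-* x (n % d) _ ⟩
    x ^ (n % d) * x ^ (d ℕ.* (n / d))  ≈⟨ *-congˡ (^-assocʳ x d (n / d)) ⟨
    x ^ (n % d) * (x ^ d) ^ (n / d)    ≈⟨ *-congˡ (trans (^-congˡ (n / d) x^d≈1) (1^ (n / d))) ⟩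
    x ^ (n % d) * 1#                   ≈⟨ *-identityʳ _ ⟩
    x ^ (n % d)                        ∎
    where
    n≡n%d+d*[n/d] = ≡.trans (m≡m%n+[m/n]*n n d) (≡.cong (n % d ℕ.+_) (ℕ.*-comm (n / d) d))

module GaussSum {c ℓ} (R : CommutativeRing c ℓ) where

  open CommutativeRing R hiding (zero)
  open import Algebra.Properties.Semiring.Exp semiring using (_^_)
  open import Algebra.Properties.CommutativeSemiring.Exp commutativeSemiring using (^-distrib-*)
  open Powers commutativeSemiring using (1^; ^-%)
  open import Data.Nat.DivMod using (_%_)
  open import Data.Nat.Primality using (Prime)

  -- For a primitive fifth root of unity ζ this is the Gauss sum ζ − ζ² − ζ³ + ζ⁴,
  -- and conjugate ζ r is its image under ζ ↦ ζʳ.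
  gauss : Carrier → Carrier
  gauss ζ = ζ * ((1# - ζ) * (1# - ζ * ζ))

  conjugate : Carrier → ℕ → Carrier
  conjugate ζ r = ζ ^ r * ((1# - ζ ^ r) * (1# - (ζ * ζ) ^ r))

  module _ {ζ} (ζ⁵≈1 : ζ ^ 5 ≈ 1#) {p} (pp : Prime p) where

    open RingCongruence R p
    open import Relation.Binary.Reasoning.Preorder ≋-preorder

    private
      frobenius-1- : ∀ x → (1# - x) ^ p ≋ 1# - x ^ p
      frobenius-1- x = ≋-trans (frobenius pp 1# (- x)) (≋-+ (≋-reflexive (1^ p)) (frobenius-neg pp x))

      [ζ²]⁵≈1 : (ζ * ζ) ^ 5 ≈ 1#
      [ζ²]⁵≈1 = trans (^-distrib-* ζ ζ 5) (trans (*-cong ζ⁵≈1 ζ⁵≈1) (*-identityˡ 1#))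

    gauss^p : gauss ζ ^ p ≋ conjugate ζ (p % 5)
    gauss^p = begin
      (ζ * ((1# - ζ) * (1# - ζ * ζ))) ^ p          ≈⟨ trans (^-distrib-* ζ _ p) (*-congˡ (^-distrib-* _ _ p)) ⟩
      ζ ^ p * ((1# - ζ) ^ p * (1# - ζ * ζ) ^ p)     ∼⟨ ≋-* ≋-refl (≋-* (frobenius-1- ζ) (frobenius-1- (ζ * ζ))) ⟩
      ζ ^ p * ((1# - ζ ^ p) * (1# - (ζ * ζ) ^ p))
        ≈⟨ *-cong ζ^p≈ (*-cong (+-congˡ (-‿cong ζ^p≈)) (+-congˡ (-‿cong [ζ²]^p≈))) ⟩
      conjugate ζ (p % 5)                           ∎
      where
      ζ^p≈ = ^-% 5 ζ⁵≈1 p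
      [ζ²]^p≈ = ^-% 5 [ζ²]⁵≈1 p

    [1+gauss]^p : (1# + gauss ζ) ^ p ≋ 1# + conjugate ζ (p % 5)
    [1+gauss]^p = ≋-trans (frobenius pp 1# (gauss ζ)) (≋-+ (≋-reflexive (1^ p)) gauss^p)

module GroupRing where

  open import Data.Integer.Base using (ℤ; +_; _+_; _*_; -_)
  import Data.Integer.Properties as ℤ
  open import Data.Integer.Tactic.RingSolver using (solve-∀)
  open import Data.Product using (_,_)
  open import Level using (0ℓ)
  open import Algebra.Consequences.Propositional using (comm∧idˡ⇒id; comm∧idʳ⇒id; comm∧invˡ⇒inv; comm∧distrˡ⇒distrʳ)
  open import Relation.Binary.PropositionalEquality

  -- ℤ[C₅] = ℤ[ζ]/(ζ⁵ − 1), an element being its coefficients on 1, ζ, …, ζ⁴.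
  record ℤ[C₅] : Set where
    constructor mk
    field c₀ c₁ c₂ c₃ c₄ : ℤ

  open ℤ[C₅] public

  mk-cong : ∀ {a₀ a₁ a₂ a₃ a₄ b₀ b₁ b₂ b₃ b₄} → a₀ ≡ b₀ → a₁ ≡ b₁ → a₂ ≡ b₂ → a₃ ≡ b₃ → a₄ ≡ b₄ →
            mk a₀ a₁ a₂ a₃ a₄ ≡ mk b₀ b₁ b₂ b₃ b₄
  mk-cong refl refl refl refl refl = refl

  infixl 6 _⊕_
  infixl 7 _⊛_
  infix  8 ⊖_

  _⊕_ : ℤ[C₅] → ℤ[C₅] → ℤ[C₅]
  mk a₀ a₁ a₂ a₃ a₄ ⊕ mk b₀ b₁ b₂ b₃ b₄ = mk (a₀ + b₀) (a₁ + b₁) (a₂ + b₂) (a₃ + b₃) (a₄ + b₄)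

  ⊖_ : ℤ[C₅] → ℤ[C₅]
  ⊖ mk a₀ a₁ a₂ a₃ a₄ = mk (- a₀) (- a₁) (- a₂) (- a₃) (- a₄)

  𝟘 𝟙 : ℤ[C₅]
  𝟘 = mk (+ 0) (+ 0) (+ 0) (+ 0) (+ 0)
  𝟙 = mk (+ 1) (+ 0) (+ 0) (+ 0) (+ 0)

  -- rotate is multiplication by ζ⁻¹, and ⟪ x , y ⟫ is the constant coefficient of x y.
  -- Coefficient k of x ⊛ y is ⟪ ζ⁻ᵏ x , y ⟫, so rotate (x ⊛ y) and rotate x ⊛ y agree
  -- definitionally and every ring law reduces to an identity between constant coefficients.
  rotate : ℤ[C₅] → ℤ[C₅]
  rotate (mk a₀ a₁ a₂ a₃ a₄) = mk a₁ a₂ a₃ a₄ a₀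

  rotate^ : ℕ → ℤ[C₅] → ℤ[C₅]
  rotate^ zero    x = x
  rotate^ (suc k) x = rotate (rotate^ k x)

  ⟪_,_⟫ : ℤ[C₅] → ℤ[C₅] → ℤ
  ⟪ mk a₀ a₁ a₂ a₃ a₄ , mk b₀ b₁ b₂ b₃ b₄ ⟫ = a₀ * b₀ + a₁ * b₄ + a₂ * b₃ + a₃ * b₂ + a₄ * b₁

  _⊛_ : ℤ[C₅] → ℤ[C₅] → ℤ[C₅]
  x ⊛ y = mk (coeff 0) (coeff 1) (coeff 2) (coeff 3) (coeff 4)
    where coeff = λ k → ⟪ rotate^ k x , y ⟫

  ⟪⟫-comm : ∀ x y → ⟪ x , y ⟫ ≡ ⟪ y , x ⟫
  ⟪⟫-comm (mk a₀ a₁ a₂ a₃ a₄) (mk b₀ b₁ b₂ b₃ b₄) = identity a₀ a₁ a₂ a₃ a₄ b₀ b₁ b₂ b₃ b₄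
    where
    identity : ∀ a₀ a₁ a₂ a₃ a₄ b₀ b₁ b₂ b₃ b₄ →
      a₀ * b₀ + a₁ * b₄ + a₂ * b₃ + a₃ * b₂ + a₄ * b₁ ≡ b₀ * a₀ + b₁ * a₄ + b₂ * a₃ + b₃ * a₂ + b₄ * a₁
    identity = solve-∀

  ⟪rotate⟫ : ∀ x y → ⟪ rotate x , y ⟫ ≡ ⟪ x , rotate y ⟫
  ⟪rotate⟫ (mk a₀ a₁ a₂ a₃ a₄) (mk b₀ b₁ b₂ b₃ b₄) = identity a₀ a₁ a₂ a₃ a₄ b₀ b₁ b₂ b₃ b₄
    where
    identity : ∀ a₀ a₁ a₂ a₃ a₄ b₀ b₁ b₂ b₃ b₄ →
      a₁ * b₀ + a₂ * b₄ + a₃ * b₃ + a₄ * b₂ + a₀ * b₁ ≡ a₀ * b₁ + a₁ * b₀ + a₂ * b₄ + a₃ * b₃ + a₄ * b₂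
    identity = solve-∀

  ⟪⟫-distrib : ∀ x y z → ⟪ x , y ⊕ z ⟫ ≡ ⟪ x , y ⟫ + ⟪ x , z ⟫
  ⟪⟫-distrib (mk a₀ a₁ a₂ a₃ a₄) (mk b₀ b₁ b₂ b₃ b₄) (mk d₀ d₁ d₂ d₃ d₄) =
    identity a₀ a₁ a₂ a₃ a₄ b₀ b₁ b₂ b₃ b₄ d₀ d₁ d₂ d₃ d₄
    where
    identity : ∀ a₀ a₁ a₂ a₃ a₄ b₀ b₁ b₂ b₃ b₄ d₀ d₁ d₂ d₃ d₄ →
      a₀ * (b₀ + d₀) + a₁ * (b₄ + d₄) + a₂ * (b₃ + d₃) + a₃ * (b₂ + d₂) + a₄ * (b₁ + d₁) ≡
      (a₀ * b₀ + a₁ * b₄ + a₂ * b₃ + a₃ * b₂ + a₄ * b₁) + (a₀ * d₀ + a₁ * d₄ + a₂ * d₃ + a₃ * d₂ + a₄ * d₁)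
    identity = solve-∀

  ⟪⟫-𝟙 : ∀ x → ⟪ x , 𝟙 ⟫ ≡ c₀ x
  ⟪⟫-𝟙 (mk a₀ a₁ a₂ a₃ a₄) = identity a₀ a₁ a₂ a₃ a₄
    where
    identity : ∀ a₀ a₁ a₂ a₃ a₄ → a₀ * + 1 + a₁ * + 0 + a₂ * + 0 + a₃ * + 0 + a₄ * + 0 ≡ a₀
    identity = solve-∀

  ⟪⟫-assoc : ∀ x y z → ⟪ x ⊛ y , z ⟫ ≡ ⟪ x , y ⊛ z ⟫
  ⟪⟫-assoc (mk a₀ a₁ a₂ a₃ a₄) (mk b₀ b₁ b₂ b₃ b₄) (mk d₀ d₁ d₂ d₃ d₄) =
    identity a₀ a₁ a₂ a₃ a₄ b₀ b₁ b₂ b₃ b₄ d₀ d₁ d₂ d₃ d₄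
    where
    identity : ∀ a₀ a₁ a₂ a₃ a₄ b₀ b₁ b₂ b₃ b₄ d₀ d₁ d₂ d₃ d₄ →
        (a₀ * b₀ + a₁ * b₄ + a₂ * b₃ + a₃ * b₂ + a₄ * b₁) * d₀
      + (a₁ * b₀ + a₂ * b₄ + a₃ * b₃ + a₄ * b₂ + a₀ * b₁) * d₄
      + (a₂ * b₀ + a₃ * b₄ + a₄ * b₃ + a₀ * b₂ + a₁ * b₁) * d₃
      + (a₃ * b₀ + a₄ * b₄ + a₀ * b₃ + a₁ * b₂ + a₂ * b₁) * d₂
      + (a₄ * b₀ + a₀ * b₄ + a₁ * b₃ + a₂ * b₂ + a₃ * b₁) * d₁
      ≡   a₀ * (b₀ * d₀ + b₁ * d₄ + b₂ * d₃ + b₃ * d₂ + b₄ * d₁)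
      + a₁ * (b₄ * d₀ + b₀ * d₄ + b₁ * d₃ + b₂ * d₂ + b₃ * d₁)
      + a₂ * (b₃ * d₀ + b₄ * d₄ + b₀ * d₃ + b₁ * d₂ + b₂ * d₁)
      + a₃ * (b₂ * d₀ + b₃ * d₄ + b₄ * d₃ + b₀ * d₂ + b₁ * d₁)
      + a₄ * (b₁ * d₀ + b₂ * d₄ + b₃ * d₃ + b₄ * d₂ + b₀ * d₁)
    identity = solve-∀

  ⟪rotate^⟫ : ∀ k x y → ⟪ rotate^ k x , y ⟫ ≡ ⟪ x , rotate^ k y ⟫
  ⟪rotate^⟫ zero    x y = refl
  ⟪rotate^⟫ (suc k) x y = begin
    ⟪ rotate (rotate^ k x) , y ⟫   ≡⟨ ⟪rotate⟫ (rotate^ k x) y ⟩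
    ⟪ rotate^ k x , rotate y ⟫     ≡⟨ ⟪rotate^⟫ k x (rotate y) ⟩
    ⟪ x , rotate^ k (rotate y) ⟫   ≡⟨ cong ⟪ x ,_⟫ (rotate^-rotate k y) ⟩
    ⟪ x , rotate (rotate^ k y) ⟫   ∎
    where
    open ≡-Reasoning
    rotate^-rotate : ∀ k y → rotate^ k (rotate y) ≡ rotate (rotate^ k y)
    rotate^-rotate zero    y = refl
    rotate^-rotate (suc k) y = cong rotate (rotate^-rotate k y)

  ⊛-comm : ∀ x y → x ⊛ y ≡ y ⊛ x
  ⊛-comm x y = mk-cong (coeff 0) (coeff 1) (coeff 2) (coeff 3) (coeff 4)
    where
    coeff : ∀ k → ⟪ rotate^ k x , y ⟫ ≡ ⟪ rotate^ k y , x ⟫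
    coeff k = trans (⟪rotate^⟫ k x y) (⟪⟫-comm x (rotate^ k y))

  ⊛-assoc : ∀ x y z → (x ⊛ y) ⊛ z ≡ x ⊛ (y ⊛ z)
  ⊛-assoc x y z = mk-cong (coeff 0) (coeff 1) (coeff 2) (coeff 3) (coeff 4)
    where
    coeff : ∀ k → ⟪ rotate^ k x ⊛ y , z ⟫ ≡ ⟪ rotate^ k x , y ⊛ z ⟫
    coeff k = ⟪⟫-assoc (rotate^ k x) y z

  ⊛-distribˡ : ∀ x y z → x ⊛ (y ⊕ z) ≡ x ⊛ y ⊕ x ⊛ z
  ⊛-distribˡ x y z = mk-cong (coeff 0) (coeff 1) (coeff 2) (coeff 3) (coeff 4)
    where
    coeff : ∀ k → ⟪ rotate^ k x , y ⊕ z ⟫ ≡ ⟪ rotate^ k x , y ⟫ + ⟪ rotate^ k x , z ⟫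
    coeff k = ⟪⟫-distrib (rotate^ k x) y z

  ⊛-identityʳ : ∀ x → x ⊛ 𝟙 ≡ x
  ⊛-identityʳ x = mk-cong (coeff 0) (coeff 1) (coeff 2) (coeff 3) (coeff 4)
    where
    coeff : ∀ k → ⟪ rotate^ k x , 𝟙 ⟫ ≡ c₀ (rotate^ k x)
    coeff k = ⟪⟫-𝟙 (rotate^ k x)

  ⊕-assoc : ∀ x y z → (x ⊕ y) ⊕ z ≡ x ⊕ (y ⊕ z)
  ⊕-assoc x y z = mk-cong (law c₀) (law c₁) (law c₂) (law c₃) (law c₄)
    where law = λ (c : ℤ[C₅] → ℤ) → ℤ.+-assoc (c x) (c y) (c z)

  ⊕-comm : ∀ x y → x ⊕ y ≡ y ⊕ x
  ⊕-comm x y = mk-cong (law c₀) (law c₁) (law c₂) (law c₃) (law c₄)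
    where law = λ (c : ℤ[C₅] → ℤ) → ℤ.+-comm (c x) (c y)

  ⊕-identityˡ : ∀ x → 𝟘 ⊕ x ≡ x
  ⊕-identityˡ x = mk-cong (law c₀) (law c₁) (law c₂) (law c₃) (law c₄)
    where law = λ (c : ℤ[C₅] → ℤ) → ℤ.+-identityˡ (c x)

  ⊖-inverseˡ : ∀ x → ⊖ x ⊕ x ≡ 𝟘
  ⊖-inverseˡ x = mk-cong (law c₀) (law c₁) (law c₂) (law c₃) (law c₄)
    where law = λ (c : ℤ[C₅] → ℤ) → ℤ.+-inverseˡ (c x)

  commutativeRing : CommutativeRing 0ℓ 0ℓ
  commutativeRing = record
    { Carrier = ℤ[C₅] ; _≈_ = _≡_ ; _+_ = _⊕_ ; _*_ = _⊛_ ; -_ = ⊖_ ; 0# = 𝟘 ; 1# = 𝟙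
    ; isCommutativeRing = record
      { isRing = record
        { +-isAbelianGroup = record
          { isGroup = record
            { isMonoid = record
              { isSemigroup = record { isMagma = record { isEquivalence = isEquivalence ; ∙-cong = cong₂ _⊕_ } ; assoc = ⊕-assoc }
              ; identity = comm∧idˡ⇒id ⊕-comm ⊕-identityˡ
              }
            ; inverse = comm∧invˡ⇒inv ⊕-comm ⊖-inverseˡ
            ; ⁻¹-cong = cong ⊖_
            }
          ; comm = ⊕-comm
          }
        ; *-cong = cong₂ _⊛_
        ; *-assoc = ⊛-assoc
        ; *-identity = comm∧idʳ⇒id ⊛-comm ⊛-identityʳ
        ; distrib = ⊛-distribˡ , comm∧distrˡ⇒distrʳ ⊛-comm ⊛-distribˡ
        }
      ; *-comm = ⊛-comm
      }
    }

module GoldenPowers where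

  open GroupRing
  open import Algebra.Properties.Semiring.Exp (CommutativeRing.semiring commutativeRing) using (_^_)
  open GaussSum commutativeRing using (gauss; conjugate; [1+gauss]^p)
  open import Data.Integer.Base using (ℤ; +_; 0ℤ; 1ℤ; -1ℤ; _+_; _*_; _-_)
  import Data.Integer.Base as ℤ
  open import Data.Integer.Properties using (pos-+)
  open import Data.Integer.Divisibility.Signed using (_∣_)
  open import Data.Integer.Tactic.RingSolver using (solve-∀)
  open import Data.Nat.DivMod using (_%_)
  open import Data.Nat.Primality using (Prime)
  open import Data.Sum using (_⊎_; inj₁; inj₂)
  open import Relation.Binary.PropositionalEquality
  open import Defs using (fib)

  ζ : ℤ[C₅]
  ζ = mk 0ℤ 1ℤ 0ℤ 0ℤ 0ℤ

  ω : ℤ[C₅]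
  ω = 𝟙 ⊕ gauss ζ

  ω̄ : ℤ[C₅]
  ω̄ = 𝟙 ⊕ ⊖ gauss ζ

  ψ : ℤ[C₅] → ℤ
  ψ x = c₁ x - c₂ x

  ψ-⊕ : ∀ x y → ψ (x ⊕ y) ≡ ψ x + ψ y
  ψ-⊕ (mk _ x₁ x₂ _ _) (mk _ y₁ y₂ _ _) = identity x₁ x₂ y₁ y₂
    where
    identity : ∀ x₁ x₂ y₁ y₂ → (x₁ + y₁) - (x₂ + y₂) ≡ (x₁ - x₂) + (y₁ - y₂)
    identity = solve-∀

  -- span a b d = a + b g + d N with g = gauss ζ and N = 1 + ζ + ζ² + ζ³ + ζ⁴. Since g² = 5 − N
  -- and g N = 0, multiplication by ω = 1 + g acts on (a , b) as multiplication by 1 + √5 on a + b √5.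
  span : ℤ → ℤ → ℤ → ℤ[C₅]
  span a b d = mk (a + d) (b + d) (d - b) (d - b) (b + d)

  ψ-span : ∀ a b d → ψ (span a b d) ≡ + 2 * b
  ψ-span a b d = identity a b d
    where
    identity : ∀ a b d → (b + d) - (d - b) ≡ + 2 * b
    identity = solve-∀

  ω⊛span : ∀ a b d → ω ⊛ span a b d ≡ span (a + + 5 * b) (a + b) (d - b)
  ω⊛span a b d = mk-cong (coeff₀ a b d) (coeff₁ a b d) (coeff₂ a b d) (coeff₃ a b d) (coeff₄ a b d)
    where
    coeff₀ : ∀ a b d → + 1 * (a + d) + + 1 * (b + d) + -1ℤ * (d - b) + -1ℤ * (d - b) + + 1 * (b + d) ≡ (a + + 5 * b) + (d - b)
    coeff₀ = solve-∀
    coeff₁ : ∀ a b d → + 1 * (a + d) + -1ℤ * (b + d) + -1ℤ * (d - b) + + 1 * (d - b) + + 1 * (b + d) ≡ (a + b) + (d - b)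
    coeff₁ = solve-∀
    coeff₂ : ∀ a b d → -1ℤ * (a + d) + -1ℤ * (b + d) + + 1 * (d - b) + + 1 * (d - b) + + 1 * (b + d) ≡ (d - b) - (a + b)
    coeff₂ = solve-∀
    coeff₃ : ∀ a b d → -1ℤ * (a + d) + + 1 * (b + d) + + 1 * (d - b) + + 1 * (d - b) + -1ℤ * (b + d) ≡ (d - b) - (a + b)
    coeff₃ = solve-∀
    coeff₄ : ∀ a b d → + 1 * (a + d) + + 1 * (b + d) + + 1 * (d - b) + -1ℤ * (d - b) + -1ℤ * (b + d) ≡ (a + b) + (d - b)
    coeff₄ = solve-∀

  mutual
    A B : ℕ → ℤ
    A zero    = + 1
    A (suc n) = A n + + 5 * B n
    B zero    = + 0
    B (suc n) = A n + B n

  D : ℕ → ℤ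
  D zero    = + 0
  D (suc n) = D n - B n

  ω^n≡span : ∀ n → ω ^ n ≡ span (A n) (B n) (D n)
  ω^n≡span zero    = refl
  ω^n≡span (suc n) = trans (cong (ω ⊛_) (ω^n≡span n)) (ω⊛span (A n) (B n) (D n))

  2B≡2ⁿF : ∀ n → + 2 * B n ≡ (+ 2) ℤ.^ n * + fib n
  2B≡2ⁿF zero          = refl
  2B≡2ⁿF (suc zero)    = refl
  2B≡2ⁿF (suc (suc n)) = begin
    + 2 * B (suc (suc n))
      ≡⟨ recurrence (A n) (B n) ⟩
    + 2 * (+ 2 * B (suc n)) + + 4 * (+ 2 * B n)
      ≡⟨ cong₂ (λ u v → + 2 * u + + 4 * v) (2B≡2ⁿF (suc n)) (2B≡2ⁿF n) ⟩
    + 2 * ((+ 2) ℤ.^ suc n * + F₁) + + 4 * ((+ 2) ℤ.^ n * + F₀)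
      ≡⟨ fib-recurrence ((+ 2) ℤ.^ n) (+ F₁) (+ F₀) ⟩
    (+ 2) ℤ.^ suc (suc n) * (+ F₁ + + F₀)
      ≡⟨ cong ((+ 2) ℤ.^ suc (suc n) *_) (pos-+ F₁ F₀) ⟨
    (+ 2) ℤ.^ suc (suc n) * + fib (suc (suc n))
      ∎
    where
    open ≡-Reasoning
    F₁ = fib (suc n)
    F₀ = fib n
    recurrence : ∀ a b → + 2 * ((a + + 5 * b) + (a + b)) ≡ + 2 * (+ 2 * (a + b)) + + 4 * (+ 2 * b)
    recurrence = solve-∀
    fib-recurrence : ∀ t f₁ f₀ → + 2 * ((+ 2 * t) * f₁) + + 4 * (t * f₀) ≡ (+ 2 * (+ 2 * t)) * (f₁ + f₀)
    fib-recurrence = solve-∀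

  ψ[ω^n] : ∀ n → ψ (ω ^ n) ≡ (+ 2) ℤ.^ n * + fib n
  ψ[ω^n] n = trans (cong ψ (ω^n≡span n)) (trans (ψ-span (A n) (B n) (D n)) (2B≡2ⁿF n))

  _≡±1[mod5] _≡±2[mod5] : ℕ → Set
  n ≡±1[mod5] = n % 5 ≡ 1 ⊎ n % 5 ≡ 4
  n ≡±2[mod5] = n % 5 ≡ 2 ⊎ n % 5 ≡ 3

  module _ {p} (pp : Prime p) where

    open RingCongruence commutativeRing p

    ψ-≋ : ∀ {x y} → x ≋ y → + p ∣ ψ x - ψ y
    ψ-≋ = ≋⇒∣ ψ (cong ψ) refl ψ-⊕

    -- conjugate ζ r evaluates to gauss ζ for r = 1, 4 and to ⊖ gauss ζ for r = 2, 3.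
    ω^p≋ω : p ≡±1[mod5] → ω ^ p ≋ ω
    ω^p≋ω (inj₁ p%5≡1) = subst (λ r → ω ^ p ≋ 𝟙 ⊕ conjugate ζ r) p%5≡1 ([1+gauss]^p refl pp)
    ω^p≋ω (inj₂ p%5≡4) = subst (λ r → ω ^ p ≋ 𝟙 ⊕ conjugate ζ r) p%5≡4 ([1+gauss]^p refl pp)

    ω^p≋ω̄ : p ≡±2[mod5] → ω ^ p ≋ ω̄
    ω^p≋ω̄ (inj₁ p%5≡2) = subst (λ r → ω ^ p ≋ 𝟙 ⊕ conjugate ζ r) p%5≡2 ([1+gauss]^p refl pp)
    ω^p≋ω̄ (inj₂ p%5≡3) = subst (λ r → ω ^ p ≋ 𝟙 ⊕ conjugate ζ r) p%5≡3 ([1+gauss]^p refl pp)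

    p∣2^p*F[p]-2 : p ≡±1[mod5] → + p ∣ (+ 2) ℤ.^ p * + fib p - + 2
    p∣2^p*F[p]-2 p≡±1 = subst (λ v → + p ∣ v - + 2) (ψ[ω^n] p) (ψ-≋ (ω^p≋ω p≡±1))

    p∣2^[p+1]*F[p+1]-4 : p ≡±1[mod5] → + p ∣ (+ 2) ℤ.^ suc p * + fib (suc p) - + 4
    p∣2^[p+1]*F[p+1]-4 p≡±1 = subst (λ v → + p ∣ v - + 4) (ψ[ω^n] (suc p)) (ψ-≋ (≋-* (≋-refl {ω}) (ω^p≋ω p≡±1)))

    p∣2^[p+1]*F[p+1] : p ≡±2[mod5] → + p ∣ (+ 2) ℤ.^ suc p * + fib (suc p) - 0ℤ
    p∣2^[p+1]*F[p+1] p≡±2 = subst (λ v → + p ∣ v - 0ℤ) (ψ[ω^n] (suc p)) (ψ-≋ (≋-* (≋-refl {ω}) (ω^p≋ω̄ p≡±2)))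

module FermatForTwo where

  open import Data.Integer.Base as ℤ using (+_; 1ℤ; _-_)
  open import Data.Integer.Properties using (+-*-commutativeRing)
  open import Data.Integer.Divisibility.Signed using (_∣_)
  open import Data.Nat.Primality using (Prime)
  open import Function.Base using (id)
  open import Relation.Binary.PropositionalEquality
  open CommutativeRing +-*-commutativeRing using (_+_; commutativeSemiring; semiring)
  open import Algebra.Properties.Semiring.Exp semiring using (_^_)
  open Powers commutativeSemiring using (1^)

  ^≡ℤ^ : ∀ x n → x ^ n ≡ x ℤ.^ n
  ^≡ℤ^ x zero    = refl
  ^≡ℤ^ x (suc n) = cong (x ℤ.*_) (^≡ℤ^ x n)

  p∣2^p-2 : ∀ {p} → Prime p → + p ∣ (+ 2) ℤ.^ p - + 2
  p∣2^p-2 {p} pp = subst₂ (λ u v → + p ∣ u - v) (^≡ℤ^ (+ 2) p) (cong₂ _+_ (1^ p) (1^ p))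
    (≋⇒∣ id id refl (λ _ _ → refl) (frobenius pp 1ℤ 1ℤ))
    where open RingCongruence +-*-commutativeRing p

open import Defs
open import Data.Nat.Base
open import Data.Nat.Properties
open import Data.Nat.Divisibility
open import Data.Nat.DivMod
open import Data.Nat.Primality
open import Data.Nat.Coprimality using (coprime-divisor; prime⇒coprime)
open import Data.Nat.Tactic.RingSolver using (solve-∀)
open import Data.Integer.Base as ℤ using (+_)
import Data.Integer.Properties as ℤ
import Data.Integer.Divisibility.Signed as ℤ
import Data.Integer.Tactic.RingSolver as ℤ-Solver
open import Data.Product using (_×_; _,_; proj₁; proj₂)
open import Data.Sum using (_⊎_; inj₁; inj₂; [_,_]′)
open import Relation.Nullary using (¬_; contradiction)
open import Relation.Nullary.Decidable using (from-yes; _→-dec_)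
open import Relation.Binary.PropositionalEquality
open FibonacciDivisibility
open GoldenPowers using (_≡±1[mod5]; _≡±2[mod5]; p∣2^p*F[p]-2; p∣2^[p+1]*F[p+1]-4; p∣2^[p+1]*F[p+1])
open FermatForTwo using (p∣2^p-2)

odd-prime : ∀ {p} → Prime p → p ≢ 2 → 2 < p
odd-prime pp p≢2 = ≤∧≢⇒< (nonTrivial⇒n>1 _ {{prime⇒nonTrivial pp}}) (≢-sym p≢2)

≡±1[mod5]⇒≢2 : ∀ {p} → p ≡±1[mod5] → p ≢ 2
≡±1[mod5]⇒≢2 (inj₁ ()) refl
≡±1[mod5]⇒≢2 (inj₂ ()) refl

∣2^k*⇒∣ : ∀ {p} → Prime p → 2 < p → ∀ k {i} → + p ℤ.∣ (+ 2) ℤ.^ k ℤ.* i → + p ℤ.∣ i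
∣2^k*⇒∣ pp 2<p zero    {i} p∣ = subst (_ ℤ.∣_) (ℤ.*-identityˡ i) p∣
∣2^k*⇒∣ {p} pp 2<p (suc k) {i} p∣ = ∣2^k*⇒∣ pp 2<p k (ℤ.∣ᵤ⇒∣ p∣2^k*i)
  where
  p∣2*[2^k*i] : p ∣ 2 * ℤ.∣ (+ 2) ℤ.^ k ℤ.* i ∣
  p∣2*[2^k*i] = subst (p ∣_) (ℤ.abs-* (+ 2) ((+ 2) ℤ.^ k ℤ.* i))
    (ℤ.∣⇒∣ᵤ (subst (+ p ℤ.∣_) (ℤ.*-assoc (+ 2) ((+ 2) ℤ.^ k) i) p∣))
  p∣2^k*i = coprime-divisor (prime⇒coprime pp 2<p) p∣2*[2^k*i]

fib[1+n]>0 : ∀ n → 0 < fib (suc n)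
fib[1+n]>0 zero    = z<s
fib[1+n]>0 (suc n) = ≤-trans (fib[1+n]>0 n) (m≤m+n _ _)

p∣F[p-1]∧F[p]≡1 : ∀ {p} .{{_ : NonZero p}} → Prime p → p ≡±1[mod5] → p ∣ fib (p ∸ 1) × fib p % p ≡ 1 % p
p∣F[p-1]∧F[p]≡1 {p@(suc m)} pp p≡±1 = ℤ.∣⇒∣ᵤ p∣F[m] , %≡1 (fib[1+n]>0 m) (ℤ.∣⇒∣ᵤ p∣F[p]-1)
  where
  2<p = odd-prime pp (≡±1[mod5]⇒≢2 p≡±1)
  X = (+ 2) ℤ.^ p
  F₀ = + fib m
  F₁ = + fib p
  F₂ = + fib (suc p)
  p∣F[p]-1 : + p ℤ.∣ F₁ ℤ.- + 1
  p∣F[p]-1 = ∣2^k*⇒∣ pp 2<p 1 (subst (+ p ℤ.∣_) (identity X F₁)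
    (ℤ.∣m∣n⇒∣m-n (p∣2^p*F[p]-2 pp p≡±1) (ℤ.∣n⇒∣m*n F₁ (p∣2^p-2 pp))))
    where
    identity : ∀ X F → (X ℤ.* F ℤ.- + 2) ℤ.- F ℤ.* (X ℤ.- + 2) ≡ + 2 ℤ.* (F ℤ.- + 1)
    identity = ℤ-Solver.solve-∀
  p∣F[p+1]-1 : + p ℤ.∣ F₂ ℤ.- + 1
  p∣F[p+1]-1 = ∣2^k*⇒∣ pp 2<p 2 (subst (+ p ℤ.∣_) (identity X F₂)
    (ℤ.∣m∣n⇒∣m-n (p∣2^[p+1]*F[p+1]-4 pp p≡±1) (ℤ.∣n⇒∣m*n (+ 2 ℤ.* F₂) (p∣2^p-2 pp))))
    where
    identity : ∀ X F → ((+ 2 ℤ.* X) ℤ.* F ℤ.- + 4) ℤ.- (+ 2 ℤ.* F) ℤ.* (X ℤ.- + 2) ≡ + 4 ℤ.* (F ℤ.- + 1)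
    identity = ℤ-Solver.solve-∀
  p∣F[m] : + p ℤ.∣ F₀
  p∣F[m] = subst (+ p ℤ.∣_)
    (trans (cong (λ v → (v ℤ.- + 1) ℤ.- (F₁ ℤ.- + 1)) (ℤ.pos-+ (fib p) (fib m))) (identity F₁ F₀))
    (ℤ.∣m∣n⇒∣m-n p∣F[p+1]-1 p∣F[p]-1)
    where
    identity : ∀ F₁ F₀ → ((F₁ ℤ.+ F₀) ℤ.- + 1) ℤ.- (F₁ ℤ.- + 1) ≡ F₀
    identity = ℤ-Solver.solve-∀
  %≡1 : ∀ {n} → 0 < n → p ∣ ℤ.∣ + n ℤ.- + 1 ∣ → n % p ≡ 1 % p
  %≡1 {suc n} _ p∣n = %-remove-+ʳ 1 p∣n

p∣F[p+1] : ∀ {p} → Prime p → p ≢ 2 → p ≡±2[mod5] → p ∣ fib (suc p)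
p∣F[p+1] {p} pp p≢2 p≡±2 = ℤ.∣⇒∣ᵤ (∣2^k*⇒∣ pp (odd-prime pp p≢2) (suc p) {+ fib (suc p)}
  (subst (+ p ℤ.∣_) (ℤ.+-identityʳ ((+ 2) ℤ.^ suc p ℤ.* + fib (suc p))) (p∣2^[p+1]*F[p+1] pp p≡±2)))

pisano∣pred : ∀ {q π} .{{_ : NonZero q}} → Prime q → q ≡±1[mod5] → IsPisanoPeriod q π → π ∣ q ∸ 1
pisano∣pred {q@(suc m)} pq q≡±1 pisano =
  pisano∣ pisano (restart⇒period {m = m} (n∣m⇒m%n≡0 (fib m) q (proj₁ F≡)) (proj₂ F≡))
  where
  F≡ = p∣F[p-1]∧F[p]≡1 pq q≡±1

rank∣pred : ∀ {p z} → Prime p → p ≡±1[mod5] → IsRankOfApparition p z → z ∣ p ∸ 1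
rank∣pred pp p≡±1 rank = rank∣ pp rank (proj₁ (p∣F[p-1]∧F[p]≡1 {{prime⇒nonZero pp}} pp p≡±1))

rank∣suc : ∀ {p z} → Prime p → p ≢ 2 → p ≡±2[mod5] → IsRankOfApparition p z → z ∣ suc p
rank∣suc pp p≢2 p≡±2 rank = rank∣ pp rank (p∣F[p+1] pp p≢2 p≡±2)

rank∤4 : ∀ {p z} → 3 < p → IsRankOfApparition p z → ¬ z ∣ 4
rank∤4 {p} p>3 (_ , p∣F[z] , _) (divides k 4≡k*z) =
  <⇒≱ p>3 (∣⇒≤ (subst (λ n → p ∣ fib n) (sym 4≡k*z) (∣fib-* k _ p∣F[z])))

prime∤ : ∀ {p d} → Prime p → 1 < d → d < p → ¬ d ∣ p
prime∤ pp 1<d d<p d∣p = [ (λ d≡1 → <⇒≢ 1<d (sym d≡1)) , <⇒≢ d<p ]′ (prime⇒irreducible pp d∣p)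

%-2n+1 : ∀ n {r} d .{{_ : NonZero d}} → n % d ≡ r → (2 * n + 1) % d ≡ (2 * r + 1) % d
%-2n+1 n d refl = trans (cong (λ m → (2 * m + 1) % d) (m≡m%n+[m/n]*n n d))
  (trans (cong (_% d) (regroup (n % d) (n / d) d)) ([m+kn]%n≡m%n (2 * (n % d) + 1) (2 * (n / d)) d))
  where
  regroup : ∀ r k d → 2 * (r + k * d) + 1 ≡ (2 * r + 1) + 2 * k * d
  regroup = solve-∀

q<2q+1 : ∀ q → q < 2 * q + 1
q<2q+1 q = ≤-<-trans (m≤m+n q (q + 0)) (m<m+n (2 * q) z<s)

suc[2q+1]≡2[q-1]+4 : ∀ q .{{_ : NonZero q}} → suc (2 * q + 1) ≡ 2 * (q ∸ 1) + 4
suc[2q+1]≡2[q-1]+4 (suc r) = identity r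
  where
  identity : ∀ r → 1 + (2 * (1 + r) + 1) ≡ 2 * r + 4
  identity = solve-∀

[2q+1]∸1≡2[q-1]+2 : ∀ q .{{_ : NonZero q}} → 2 * q + 1 ∸ 1 ≡ 2 * (q ∸ 1) + 2
[2q+1]∸1≡2[q-1]+2 (suc r) = trans (m+n∸n≡m (2 * suc r) 1) (identity r)
  where
  identity : ∀ r → 2 * (1 + r) ≡ 2 * r + 2
  identity = solve-∀

sophieGermain-mod3 : ∀ {q} → SophieGermain q → 3 < q → q % 3 ≡ 2
sophieGermain-mod3 {q} (q-prime , p-prime) q>3 with q % 3 in q%3≡r | m%n<n q 3
... | 0 | _ = contradiction (m%n≡0⇒n∣m q 3 q%3≡r) (prime∤ q-prime (from-yes (1 <? 3)) q>3)
... | 1 | _ = contradiction (m%n≡0⇒n∣m _ 3 (%-2n+1 q 3 q%3≡r)) (prime∤ p-prime (from-yes (1 <? 3)) (<-trans q>3 (q<2q+1 q)))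
... | 2 | _ = refl
... | suc (suc (suc _)) | s<s (s<s (s<s ()))

sophieGermain-mod5 : ∀ {q} → SophieGermain q → 5 < q →
  (q % 5 ≡ 1 × (2 * q + 1) % 5 ≡ 3) ⊎ q % 5 ≡ 3 ⊎ (q % 5 ≡ 4 × (2 * q + 1) % 5 ≡ 4)
sophieGermain-mod5 {q} (q-prime , p-prime) q>5 with q % 5 in q%5≡r | m%n<n q 5
... | 0 | _ = contradiction (m%n≡0⇒n∣m q 5 q%5≡r) (prime∤ q-prime (from-yes (1 <? 5)) q>5)
... | 1 | _ = inj₁ (refl , %-2n+1 q 5 q%5≡r)
... | 2 | _ = contradiction (m%n≡0⇒n∣m _ 5 (%-2n+1 q 5 q%5≡r)) (prime∤ p-prime (from-yes (1 <? 5)) (<-trans q>5 (q<2q+1 q)))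
... | 3 | _ = inj₂ (inj₁ refl)
... | 4 | _ = inj₂ (inj₂ (refl , %-2n+1 q 5 q%5≡r))
... | suc (suc (suc (suc (suc _)))) | s<s (s<s (s<s (s<s (s<s ()))))

mod15 : ∀ q → q % 3 ≡ 2 → q % 5 ≡ 3 → q % 15 ≡ 8
mod15 q q%3≡2 q%5≡3 = table (m%n<n q 15) (trans (m∣n⇒o%n%m≡o%m 3 15 q (divides 5 refl)) q%3≡2)
  (trans (m∣n⇒o%n%m≡o%m 5 15 q (divides 3 refl)) q%5≡3)
  where
  table : ∀ {r} → r < 15 → r % 3 ≡ 2 → r % 5 ≡ 3 → r ≡ 8
  table = from-yes (allUpTo? (λ r → (r % 3 ≟ 2) →-dec (r % 5 ≟ 3) →-dec (r ≟ 8)) 15)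

theorem7p1 : (q : ℕ) → .{{_ : NonZero q}} → SophieGermain q → 5 < q →
    (z π : ℕ) → IsRankOfApparition (2 * q + 1) z → IsPisanoPeriod q π →
    z ∣ π → q % 15 ≡ 8
theorem7p1 q sg@(q-prime , p-prime) q>5 z π rank pisano z∣π = by-residue-mod5 (sophieGermain-mod5 sg q>5)
  where
  q>3 = <-trans (from-yes (3 <? 5)) q>5
  p>3 = <-trans q>3 (q<2q+1 q)
  p≢2 = >⇒≢ (<-trans (from-yes (2 <? 3)) p>3)
  z∣2[q-1]+c⇒z∣c : ∀ c {n} → n ≡ 2 * (q ∸ 1) + c → z ∣ n → q ≡±1[mod5] → z ∣ c
  z∣2[q-1]+c⇒z∣c c refl z∣n q≡±1 = ∣m+n∣m⇒∣n z∣n (∣n⇒∣m*n 2 (∣-trans z∣π (pisano∣pred q-prime q≡±1 pisano)))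
  by-residue-mod5 : (q % 5 ≡ 1 × (2 * q + 1) % 5 ≡ 3) ⊎ q % 5 ≡ 3 ⊎ (q % 5 ≡ 4 × (2 * q + 1) % 5 ≡ 4) → q % 15 ≡ 8
  by-residue-mod5 (inj₂ (inj₁ q≡3)) = mod15 q (sophieGermain-mod3 sg q>3) q≡3
  by-residue-mod5 (inj₁ (q≡1 , p≡3)) = contradiction
    (z∣2[q-1]+c⇒z∣c 4 (suc[2q+1]≡2[q-1]+4 q) (rank∣suc p-prime p≢2 (inj₂ p≡3) rank) (inj₁ q≡1))
    (rank∤4 p>3 rank)
  by-residue-mod5 (inj₂ (inj₂ (q≡4 , p≡4))) = contradiction
    (∣-trans (z∣2[q-1]+c⇒z∣c 2 ([2q+1]∸1≡2[q-1]+2 q) (rank∣pred p-prime (inj₂ p≡4) rank) (inj₂ q≡4)) (divides 2 refl))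
    (rank∤4 p>3 rank)
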